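{- Let $p$ be a prime, and let $k,n,m,n_0,m_0$ be nonnegative integers such that $k\ge 1$ and $0\le n_0,m_0\le p-1$. (a) If $p\ge 5$, then $$\binom{np^k+n_0}{mp^k+m_0}\equiv \binom{np^{\lfloor (k-1)/3\rfloor}}{mp^{\lfloor (k-1)/3\rfloor}}\binom{n_0}{m_0}\pmod{p^k}.$$ (b) If $p=2$, then $$\binom{n2^k+n_0}{m2^k+m_0}\equiv \binom{n2^{\lfloor k/2\rfloor}}{m2^{\lfloor k/2\rfloor}}\binom{n_0}{m_0}\pmod{2^k}.$$ (c) If $p=3$, then $$\binom{n3^k+n_0}{m3^k+m_0}\equiv \binom{n3^{\lfloor (k-1)/2\rfloor}}{m3^{\lfloor (k-1)/2\rfloor}}\binom{n_0}{m_0}\pmod{3^k}.$$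
   Context: $\lfloor a\rfloor$ denotes the greatest integer less than or equal to $a$. Binomial coefficients follow the conventions $\binom{0}{0}=1$ and $\binom{l}{r}=0$ whenever $l<r$ (for nonnegative integers $l,r$). -}

module Defs where

open import Data.Nat using (ℕ; NonZero; _%_)
open import Relation.Binary.PropositionalEquality using (_≡_)

ModEq : (M : ℕ) → .{{NonZero M}} → ℕ → ℕ → Set
ModEq M a b = a % M ≡ b % M

{-# OPTIONS --safe #-}

-- Lucas' theorem splits off the last base-p digits modulo p ^ k, so everything rests on the
-- Jacobsthal-type step binom (n p^(j+1)) (m p^(j+1)) ≡ binom (n p^j) (m p^j) modulo p^(3(j+1))
-- for p ≥ 5, p^(2(j+1)) for p = 3 and 2^(2j+1) for p = 2; from the stated exponent up to k every
-- step holds modulo p ^ k.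
-- Cancelling the multiples of p from the rising products (c p + 1) ⋯ (c p + b p) and 1 ⋯ b p gives
-- binom (p (c + b)) (p b) · U(0) = binom (c + b) b · U(c p), where U(z) is the product of the z + i
-- with 1 ≤ i ≤ p b and p ∤ i.  Cut into blocks of length N = p^(j+1), the step reduces to
-- U_N(s N) ≡ U_N(0).  Writing U_N(s N) = U_N(0) + N V and pairing i with N - i in U_N(s N)² gives
-- N V (2 U_N(0) + N V) = T (L + T W) with T = s (s + 1) N², where L is a Wolstenholme-type sum
-- divisible by N when p ≥ 5; for odd p the factor 2 U_N(0) + N V is prime to p.
module Submission where

open import Defs
open import Data.Empty using (⊥-elim)
open import Data.Fin using (Fin; toℕ; fromℕ<)
open import Data.Fin.Permutation using (Permutation; permutation; _⟨$⟩ʳ_)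
open import Data.Fin.Properties using (toℕ<n; toℕ-fromℕ<; toℕ-injective)
import Data.Integer as ℤ
import Data.Integer.Divisibility.Signed as ℤ
import Data.Integer.Properties as ℤ
import Data.Integer.Tactic.RingSolver as ℤ
open import Data.Nat using (ℕ; zero; suc; _+_; _*_; _∸_; _^_; _≤_; _<_; _/_; _%_; NonZero; s≤s; z<s; s<s; s≤s⁻¹; s<s⁻¹; >-nonZero; _≟_; _≤?_)
open import Data.Nat.Combinatorics using (_C_; nCk+nC[k+1]≡[n+1]C[k+1])
open import Data.Nat.Coprimality using (prime⇒coprime)
open import Data.Nat.DivMod using ([m+kn]%n≡m%n; m<n⇒m%n≡m; m*n%n≡0; m≡m%n+[m/n]*n; m%n<n; m/n≤m)
open import Data.Nat.Divisibility
  using (_∣_; _∤_; divides; ∣-refl; ∣-trans; _∣0; 1∣_; ∣1⇒≡1; ∣⇒≤; ∣m⇒∣m*n; ∣n⇒∣m*n; m*n∣⇒m∣; *-pres-∣; *-cancelˡ-∣; ∣m∣n⇒∣m+n; ∣m+n∣m⇒∣n; m%n≡0⇒n∣m; n∣m⇒m%n≡0)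
open import Data.Nat.Primality using (Prime; prime⇒nonZero; euclidsLemma; ¬prime[1]; prime[2]; prime?)
open import Data.Nat.Properties
open import Data.Nat.Tactic.RingSolver using (solve-∀)
open import Data.Product using (_×_; _,_)
open import Data.Sum using (inj₁; inj₂)
open import Data.Unit using (tt)
open import Function using (_∘_)
open import Relation.Nullary using (yes; no)
open import Relation.Nullary.Decidable using (toWitness)
open import Relation.Binary.PropositionalEquality
open import Algebra.Properties.CommutativeMonoid.Sum *-1-commutativeMonoid using (sum; sum-cong-≗; sum-permute)
open ≡-Reasoning

prod : (ℕ → ℕ) → ℕ → ℕ
prod f zero    = 1
prod f (suc n) = f 0 * prod (f ∘ suc) n

prod-cong : ∀ n {f g : ℕ → ℕ} → (∀ i → i < n → f i ≡ g i) → prod f n ≡ prod g n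
prod-cong zero    eq = refl
prod-cong (suc n) eq = cong₂ _*_ (eq 0 z<s) (prod-cong n (λ i i<n → eq (suc i) (s<s i<n)))

prod-init-last : ∀ n (f : ℕ → ℕ) → prod f (suc n) ≡ prod f n * f n
prod-init-last zero    f = *-comm (f 0) 1
prod-init-last (suc n) f = begin
  f 0 * prod (f ∘ suc) (suc n)    ≡⟨ cong (f 0 *_) (prod-init-last n (f ∘ suc)) ⟩
  f 0 * (prod (f ∘ suc) n * f (suc n)) ≡⟨ *-assoc (f 0) _ _ ⟨
  f 0 * prod (f ∘ suc) n * f (suc n) ∎

prod-+ : ∀ m n (f : ℕ → ℕ) → prod f (m + n) ≡ prod f m * prod (λ i → f (m + i)) n
prod-+ zero    n f = sym (+-identityʳ _)
prod-+ (suc m) n f = trans (cong (f 0 *_) (prod-+ m n (f ∘ suc))) (sym (*-assoc (f 0) _ _))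

prod-* : ∀ n (f g : ℕ → ℕ) → prod (λ i → f i * g i) n ≡ prod f n * prod g n
prod-* zero    f g = refl
prod-* (suc n) f g = trans (cong (f 0 * g 0 *_) (prod-* n (f ∘ suc) (g ∘ suc)))
                           (interchange (f 0) (g 0) _ _)
  where
  interchange : ∀ a b c d → a * b * (c * d) ≡ a * c * (b * d)
  interchange = solve-∀

prod-const : ∀ n c → prod (λ _ → c) n ≡ c ^ n
prod-const zero    c = refl
prod-const (suc n) c = cong (c *_) (prod-const n c)

prod-blocks : ∀ b q (f : ℕ → ℕ) → prod f (b * q) ≡ prod (λ t → prod (λ i → f (t * q + i)) q) b
prod-blocks zero    q f = refl
prod-blocks (suc b) q f = begin
  prod f (q + b * q)                                            ≡⟨ prod-+ q (b * q) f ⟩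
  prod f q * prod (λ i → f (q + i)) (b * q)                      ≡⟨ cong (prod f q *_) (prod-blocks b q (λ i → f (q + i))) ⟩
  prod f q * prod (λ t → prod (λ i → f (q + (t * q + i))) q) b
    ≡⟨ cong (prod f q *_) (prod-cong b (λ t _ → prod-cong q (λ i _ → cong f (sym (+-assoc q (t * q) i))))) ⟩
  prod f q * prod (λ t → prod (λ i → f (suc t * q + i)) q) b     ∎

prod-reverse : ∀ n (f : ℕ → ℕ) → prod f n ≡ prod (λ i → f (n ∸ suc i)) n
prod-reverse zero    f = refl
prod-reverse (suc n) f = begin
  prod f (suc n)                      ≡⟨ prod-init-last n f ⟩
  prod f n * f n                      ≡⟨ cong (_* f n) (prod-reverse n f) ⟩
  prod (λ i → f (n ∸ suc i)) n * f n  ≡⟨ *-comm _ (f n) ⟩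
  f n * prod (λ i → f (n ∸ suc i)) n  ∎

prod-positive : ∀ n (f : ℕ → ℕ) → (∀ i → i < n → 0 < f i) → 0 < prod f n
prod-positive zero    f pos = z<s
prod-positive (suc n) f pos = *-mono-< (pos 0 z<s) (prod-positive n (f ∘ suc) (λ i i<n → pos (suc i) (s<s i<n)))

record Permutation< (n : ℕ) : Set where
  field
    to from   : ℕ → ℕ
    to-<      : ∀ i → i < n → to i < n
    from-<    : ∀ i → i < n → from i < n
    from-to   : ∀ i → i < n → from (to i) ≡ i
    to-from   : ∀ i → i < n → to (from i) ≡ i

  toFin : Permutation n n
  toFin = permutation (restrict to to-<) (restrict from from-<)
    (λ i → toℕ-injective (trans (toℕ-fromℕ< _) (trans (cong to (toℕ-fromℕ< _)) (to-from (toℕ i) (toℕ<n i)))))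
    (λ i → toℕ-injective (trans (toℕ-fromℕ< _) (trans (cong from (toℕ-fromℕ< _)) (from-to (toℕ i) (toℕ<n i)))))
    where
    restrict : (σ : ℕ → ℕ) → (∀ i → i < n → σ i < n) → Fin n → Fin n
    restrict σ σ-< i = fromℕ< (σ-< (toℕ i) (toℕ<n i))

prod-permute : ∀ n (π : Permutation< n) (f : ℕ → ℕ) → prod (f ∘ Permutation<.to π) n ≡ prod f n
prod-permute n π f = begin
  prod (f ∘ to) n                            ≡⟨ prod≡sum n (f ∘ to) ⟩
  sum {n} (f ∘ to ∘ toℕ)                     ≡⟨ sum-cong-≗ (λ i → cong f (sym (toℕ-fromℕ< (to-< (toℕ i) (toℕ<n i))))) ⟩
  sum {n} (λ i → f (toℕ (toFin ⟨$⟩ʳ i)))      ≡⟨ sum-permute (f ∘ toℕ) toFin ⟨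
  sum {n} (f ∘ toℕ)                          ≡⟨ prod≡sum n f ⟨
  prod f n                                   ∎
  where
  open Permutation< π
  prod≡sum : ∀ n (g : ℕ → ℕ) → prod g n ≡ sum {n} (g ∘ toℕ)
  prod≡sum zero    g = refl
  prod≡sum (suc n) g = cong (g 0 *_) (prod≡sum n (g ∘ suc))

binom : ℕ → ℕ → ℕ
binom n       zero    = 1
binom zero    (suc k) = 0
binom (suc n) (suc k) = binom n k + binom n (suc k)

C≡binom : ∀ n k → n C k ≡ binom n k
C≡binom n       zero    = refl
C≡binom zero    (suc k) = refl
C≡binom (suc n) (suc k) = trans (sym (nCk+nC[k+1]≡[n+1]C[k+1] n k)) (cong₂ _+_ (C≡binom n k) (C≡binom n (suc k)))

binom-< : ∀ {n k} → n < k → binom n k ≡ 0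
binom-< {zero}  {suc k} _         = refl
binom-< {suc n} {suc k} (s<s n<k) = cong₂ _+_ (binom-< n<k) (binom-< (m<n⇒m<1+n n<k))

binom-1 : ∀ n → binom n 1 ≡ n
binom-1 zero    = refl
binom-1 (suc n) = cong suc (binom-1 n)

binom-absorb : ∀ n k → binom (suc n) (suc k) * suc k ≡ suc n * binom n k
binom-absorb zero    zero    = refl
binom-absorb zero    (suc k) = refl
binom-absorb (suc n) zero    = trans (*-identityʳ _) (trans (cong (suc ∘ suc) (binom-1 n)) (sym (*-identityʳ _)))
binom-absorb (suc n) (suc k) = begin
  (x + y) * suc (suc k)                          ≡⟨ expandL x y k ⟩
  x + x * suc k + y * suc (suc k)                ≡⟨ cong₂ (λ u v → x + u + v) (binom-absorb n k) (binom-absorb n (suc k)) ⟩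
  x + suc n * binom n k + suc n * binom n (suc k) ≡⟨ collectR x n (binom n k) (binom n (suc k)) ⟩
  suc (suc n) * x                                ∎
  where
  x = binom (suc n) (suc k)
  y = binom (suc n) (suc (suc k))
  expandL : ∀ a b k → (a + b) * suc (suc k) ≡ a + a * suc k + b * suc (suc k)
  expandL = solve-∀
  collectR : ∀ a n u v → a + suc n * u + suc n * v ≡ a + suc n * (u + v)
  collectR = solve-∀

infix 4 _≡_mod_
record _≡_mod_ (a b M : ℕ) : Set where
  constructor mod-intro
  field divides-difference : ℤ.+ M ℤ.∣ (ℤ.+ a ℤ.- ℤ.+ b)

private
  ∣-resp : ∀ {M x y} → x ≡ y → ℤ.+ M ℤ.∣ x → ℤ.+ M ℤ.∣ y
  ∣-resp {M} = subst (ℤ.+ M ℤ.∣_)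

mod-refl : ∀ {M} a → a ≡ a mod M
mod-refl {M} a = mod-intro (ℤ.divides (ℤ.+ 0) (trans (ℤ.+-inverseʳ (ℤ.+ a)) (sym (ℤ.*-zeroˡ (ℤ.+ M)))))

mod-sym : ∀ {M a b} → a ≡ b mod M → b ≡ a mod M
mod-sym {M} {a} {b} (mod-intro d) = mod-intro (∣-resp (negate (ℤ.+ a) (ℤ.+ b)) (ℤ.∣m⇒∣-m d))
  where
  negate : ∀ x y → ℤ.- (x ℤ.- y) ≡ y ℤ.- x
  negate = ℤ.solve-∀

mod-trans : ∀ {M a b c} → a ≡ b mod M → b ≡ c mod M → a ≡ c mod M
mod-trans {M} {a} {b} {c} (mod-intro d₁) (mod-intro d₂) =
  mod-intro (∣-resp (telescope (ℤ.+ a) (ℤ.+ b) (ℤ.+ c)) (ℤ.∣m∣n⇒∣m+n d₁ d₂))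
  where
  telescope : ∀ x y z → (x ℤ.- y) ℤ.+ (y ℤ.- z) ≡ x ℤ.- z
  telescope = ℤ.solve-∀

mod-resp : ∀ {M a a′ b b′} → a ≡ a′ → b ≡ b′ → a ≡ b mod M → a′ ≡ b′ mod M
mod-resp refl refl c = c

mod-+ : ∀ {M a a′ b b′} → a ≡ a′ mod M → b ≡ b′ mod M → a + b ≡ a′ + b′ mod M
mod-+ {M} {a} {a′} {b} {b′} (mod-intro d₁) (mod-intro d₂) = mod-intro (∣-resp eq (ℤ.∣m∣n⇒∣m+n d₁ d₂))
  where
  regroup : ∀ x x′ y y′ → (x ℤ.- x′) ℤ.+ (y ℤ.- y′) ≡ (x ℤ.+ y) ℤ.- (x′ ℤ.+ y′)
  regroup = ℤ.solve-∀
  eq : (ℤ.+ a ℤ.- ℤ.+ a′) ℤ.+ (ℤ.+ b ℤ.- ℤ.+ b′) ≡ ℤ.+ (a + b) ℤ.- ℤ.+ (a′ + b′)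
  eq = trans (regroup (ℤ.+ a) (ℤ.+ a′) (ℤ.+ b) (ℤ.+ b′)) (sym (cong₂ ℤ._-_ (ℤ.pos-+ a b) (ℤ.pos-+ a′ b′)))

mod-* : ∀ {M a a′ b b′} → a ≡ a′ mod M → b ≡ b′ mod M → a * b ≡ a′ * b′ mod M
mod-* {M} {a} {a′} {b} {b′} (mod-intro d₁) (mod-intro d₂) =
  mod-intro (∣-resp eq (ℤ.∣m∣n⇒∣m+n (ℤ.∣n⇒∣m*n (ℤ.+ a) d₂) (ℤ.∣m⇒∣m*n (ℤ.+ b′) d₁)))
  where
  regroup : ∀ x x′ y y′ → x ℤ.* (y ℤ.- y′) ℤ.+ (x ℤ.- x′) ℤ.* y′ ≡ x ℤ.* y ℤ.- x′ ℤ.* y′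
  regroup = ℤ.solve-∀
  eq : ℤ.+ a ℤ.* (ℤ.+ b ℤ.- ℤ.+ b′) ℤ.+ (ℤ.+ a ℤ.- ℤ.+ a′) ℤ.* ℤ.+ b′ ≡ ℤ.+ (a * b) ℤ.- ℤ.+ (a′ * b′)
  eq = trans (regroup (ℤ.+ a) (ℤ.+ a′) (ℤ.+ b) (ℤ.+ b′)) (sym (cong₂ ℤ._-_ (ℤ.pos-* a b) (ℤ.pos-* a′ b′)))

mod-*ˡ : ∀ {M b b′} a → b ≡ b′ mod M → a * b ≡ a * b′ mod M
mod-*ˡ a = mod-* (mod-refl a)

mod-+-cancelʳ : ∀ {M a b} x → a + x ≡ b + x mod M → a ≡ b mod M
mod-+-cancelʳ {M} {a} {b} x (mod-intro d) = mod-intro (∣-resp eq d)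
  where
  cancel : ∀ a b x → (a ℤ.+ x) ℤ.- (b ℤ.+ x) ≡ a ℤ.- b
  cancel = ℤ.solve-∀
  eq : ℤ.+ (a + x) ℤ.- ℤ.+ (b + x) ≡ ℤ.+ a ℤ.- ℤ.+ b
  eq = trans (cong₂ ℤ._-_ (ℤ.pos-+ a x) (ℤ.pos-+ b x)) (cancel (ℤ.+ a) (ℤ.+ b) (ℤ.+ x))

mod-weaken : ∀ {M M′ a b} → M ∣ M′ → a ≡ b mod M′ → a ≡ b mod M
mod-weaken M∣M′ (mod-intro d) = mod-intro (ℤ.∣-trans (ℤ.∣ᵤ⇒∣ M∣M′) d)

≡+*⇒mod : ∀ {M a b} k → a ≡ b + k * M → a ≡ b mod M
≡+*⇒mod {M} {a} {b} k refl = mod-intro (ℤ.divides (ℤ.+ k) (begin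
  ℤ.+ (b + k * M) ℤ.- ℤ.+ b               ≡⟨ cong (ℤ._- ℤ.+ b) (trans (ℤ.pos-+ b (k * M)) (cong (ℤ._+_ (ℤ.+ b)) (ℤ.pos-* k M))) ⟩
  ℤ.+ b ℤ.+ ℤ.+ k ℤ.* ℤ.+ M ℤ.- ℤ.+ b     ≡⟨ cancel (ℤ.+ b) (ℤ.+ k) (ℤ.+ M) ⟩
  ℤ.+ k ℤ.* ℤ.+ M                        ∎))
  where
  cancel : ∀ x y z → x ℤ.+ y ℤ.* z ℤ.- x ≡ y ℤ.* z
  cancel = ℤ.solve-∀

∣⇒≡0mod : ∀ {M a} → M ∣ a → a ≡ 0 mod M
∣⇒≡0mod (divides q eq) = ≡+*⇒mod q eq

complement-* : ∀ {N} u v → u + v ≡ N → u * v + u * u ≡ 0 mod N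
complement-* u v u+v≡N = ∣⇒≡0mod (divides u (trans (sym (*-distribˡ-+ u v u)) (cong (u *_) (trans (+-comm v u) u+v≡N))))

%≡mod : ∀ {M} .{{_ : NonZero M}} x → x % M ≡ x mod M
%≡mod {M} x = mod-sym (≡+*⇒mod (x / M) (m≡m%n+[m/n]*n x M))

≡0mod⇒∣ : ∀ {M a} → a ≡ 0 mod M → M ∣ a
≡0mod⇒∣ {M} {a} (mod-intro d) = subst (M ∣_) (cong ℤ.∣_∣ (ℤ.+-identityʳ (ℤ.+ a))) (ℤ.∣⇒∣ᵤ d)

mod-≥⇒%≡ : ∀ {M a b} .{{_ : NonZero M}} → b ≤ a → a ≡ b mod M → a % M ≡ b % M
mod-≥⇒%≡ {M} {a} {b} b≤a c with ≡0mod⇒∣ (mod-+-cancelʳ b (mod-resp (sym (m∸n+n≡m b≤a)) (sym (+-identityˡ b)) c))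
... | divides q eq = begin
  a % M               ≡⟨ cong (_% M) (sym (m+[n∸m]≡n b≤a)) ⟩
  (b + (a ∸ b)) % M   ≡⟨ cong (λ z → (b + z) % M) eq ⟩
  (b + q * M) % M     ≡⟨ [m+kn]%n≡m%n b q M ⟩
  b % M               ∎

mod⇒ModEq : ∀ {M a b} .{{_ : NonZero M}} → a ≡ b mod M → ModEq M a b
mod⇒ModEq {a = a} {b} c with ≤-total b a
... | inj₁ b≤a = mod-≥⇒%≡ b≤a c
... | inj₂ a≤b = sym (mod-≥⇒%≡ a≤b (mod-sym c))

mod-prod : ∀ {M} n {f f′ : ℕ → ℕ} → (∀ i → i < n → f i ≡ f′ i mod M) → prod f n ≡ prod f′ n mod M
mod-prod zero    c = mod-refl 1
mod-prod (suc n) c = mod-* (c 0 z<s) (mod-prod n (λ i i<n → c (suc i) (s<s i<n)))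

^-monoʳ-∣ : ∀ p {a b} → a ≤ b → p ^ a ∣ p ^ b
^-monoʳ-∣ p {a} {b} a≤b = divides (p ^ (b ∸ a)) (begin
  p ^ b              ≡⟨ cong (p ^_) (sym (m+[n∸m]≡n a≤b)) ⟩
  p ^ (a + (b ∸ a))  ≡⟨ ^-distribˡ-+-* p a (b ∸ a) ⟩
  p ^ a * p ^ (b ∸ a) ≡⟨ *-comm (p ^ a) _ ⟩
  p ^ (b ∸ a) * p ^ a ∎)

prime∤1 : ∀ {p} → Prime p → p ∤ 1
prime∤1 pp p∣1 with ∣1⇒≡1 p∣1
... | refl = ¬prime[1] pp

prime∤prod : ∀ {p} → Prime p → ∀ n (f : ℕ → ℕ) → (∀ i → i < n → p ∤ f i) → p ∤ prod f n
prime∤prod pp zero    f ∤f = prime∤1 pp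
prime∤prod pp (suc n) f ∤f p∣ with euclidsLemma _ _ pp p∣
... | inj₁ p∣f0   = ∤f 0 z<s p∣f0
... | inj₂ p∣rest = prime∤prod pp n (f ∘ suc) (λ i i<n → ∤f (suc i) (s<s i<n)) p∣rest

prime^∣*-cancelˡ : ∀ {p x} → Prime p → p ∤ x → ∀ e {y} → p ^ e ∣ x * y → p ^ e ∣ y
prime^∣*-cancelˡ pp p∤x zero {y} _ = 1∣ y
prime^∣*-cancelˡ {p} {x} pp p∤x (suc e) {y} p^e+1∣xy with euclidsLemma x y pp (m*n∣⇒m∣ p (p ^ e) p^e+1∣xy)
... | inj₁ p∣x = ⊥-elim (p∤x p∣x)
... | inj₂ (divides y′ refl) with prime^∣*-cancelˡ pp p∤x e {y′}
      (*-cancelˡ-∣ p {{prime⇒nonZero pp}} (subst (p * p ^ e ∣_) (rearrange x y′ p) p^e+1∣xy))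
  where
  rearrange : ∀ x y p → x * (y * p) ≡ p * (x * y)
  rearrange = solve-∀
...   | divides q eq = divides q (trans (cong (_* p) eq) (rearrange q (p ^ e) p))
  where
  rearrange : ∀ q a p → q * a * p ≡ q * (p * a)
  rearrange = solve-∀

mod-cancelˡ : ∀ {p x} → Prime p → p ∤ x → ∀ e {a b} → x * a ≡ x * b mod p ^ e → a ≡ b mod p ^ e
mod-cancelˡ {p} {x} pp p∤x e {a} {b} (mod-intro d) =
  mod-intro (ℤ.∣ᵤ⇒∣ (prime^∣*-cancelˡ pp p∤x e (subst (p ^ e ∣_) eq (ℤ.∣⇒∣ᵤ d))))
  where
  factor : ∀ x a b → x ℤ.* a ℤ.- x ℤ.* b ≡ x ℤ.* (a ℤ.- b)
  factor = ℤ.solve-∀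
  eq : ℤ.∣ ℤ.+ (x * a) ℤ.- ℤ.+ (x * b) ∣ ≡ x * ℤ.∣ ℤ.+ a ℤ.- ℤ.+ b ∣
  eq = trans (cong ℤ.∣_∣ (trans (cong₂ ℤ._-_ (ℤ.pos-* x a) (ℤ.pos-* x b)) (factor (ℤ.+ x) (ℤ.+ a) (ℤ.+ b))))
             (ℤ.abs-* (ℤ.+ x) (ℤ.+ a ℤ.- ℤ.+ b))

prime^∣binom : ∀ {p} → Prime p → ∀ k {X} j → p ^ k ∣ X → p ∤ j → p ^ k ∣ binom X j
prime^∣binom pp k {X}     zero    _    p∤0 = ⊥-elim (p∤0 (_ ∣0))
prime^∣binom pp k {zero}  (suc j) _    _   = _ ∣0
prime^∣binom {p} pp k {suc X} (suc j) p^k∣X p∤j =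
  prime^∣*-cancelˡ pp p∤j k (subst (p ^ k ∣_) (trans (sym (binom-absorb X j)) (*-comm _ (suc j))) (∣m⇒∣m*n (binom X j) p^k∣X))

p∤p*t+r : ∀ {p} t {r} → 0 < r → r < p → p ∤ p * t + r
p∤p*t+r {p} t 0<r r<p p∣ with ∣m+n∣m⇒∣n p∣ (∣m⇒∣m*n t ∣-refl)
... | divides zero    eq = <⇒≢ 0<r (sym eq)
... | divides (suc q) eq = <⇒≱ r<p (subst (p ≤_) (sym eq) (m≤m+n p (q * p)))

binom-lastDigit : ∀ {p} → Prime p → ∀ k X → p ^ k ∣ X → ∀ n₀ t r → n₀ < p → r < p →
                  binom (X + n₀) (p * t + r) ≡ binom X (p * t) * binom n₀ r mod p ^ k
binom-lastDigit {p} pp k X _ zero t zero _ _ =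
  mod-resp (cong₂ binom (sym (+-identityʳ X)) (sym (+-identityʳ (p * t)))) (sym (*-identityʳ (binom X (p * t))))
    (mod-refl _)
binom-lastDigit {p} pp k X p^k∣X zero t (suc r) _ r<p =
  mod-resp (cong (λ z → binom z (p * t + suc r)) (sym (+-identityʳ X))) (sym (*-zeroʳ (binom X (p * t))))
    (∣⇒≡0mod (prime^∣binom pp k (p * t + suc r) p^k∣X (p∤p*t+r t z<s r<p)))
binom-lastDigit {p} pp k X p^k∣X (suc n₀) t (suc r) n₀<p r<p =
  mod-resp pascalˡ (sym (*-distribˡ-+ (binom X (p * t)) (binom n₀ r) (binom n₀ (suc r))))
    (mod-+ (binom-lastDigit pp k X p^k∣X n₀ t r (below n₀<p) (below r<p))
           (binom-lastDigit pp k X p^k∣X n₀ t (suc r) (below n₀<p) r<p))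
  where
  below : ∀ {a} → suc a < p → a < p
  below = <-trans (n<1+n _)
  pascalˡ : binom (X + n₀) (p * t + r) + binom (X + n₀) (p * t + suc r) ≡ binom (X + suc n₀) (p * t + suc r)
  pascalˡ = sym (trans (cong₂ binom (+-suc X n₀) (+-suc (p * t) r))
                       (cong (λ z → binom (X + n₀) (p * t + r) + binom (X + n₀) z) (sym (+-suc (p * t) r))))
binom-lastDigit {p} pp k X _ (suc n₀) zero zero _ _ =
  mod-resp (cong (binom _) (sym (trans (+-identityʳ (p * 0)) (*-zeroʳ p)))) (cong (λ z → binom X z * 1) (sym (*-zeroʳ p)))
    (mod-refl 1)
binom-lastDigit {suc p′} pp k X p^k∣X (suc n₀) (suc t) zero (s<s n₀<p′) _ =
  mod-resp pascalˡ lastDigit0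
    (mod-+ (binom-lastDigit pp k X p^k∣X n₀ t p′ (m<n⇒m<1+n n₀<p′) (n<1+n p′))
           (binom-lastDigit pp k X p^k∣X n₀ (suc t) zero (m<n⇒m<1+n n₀<p′) z<s))
  where
  p = suc p′
  borrow : p * suc t + 0 ≡ suc (p * t + p′)
  borrow = trans (+-identityʳ _) (expand p′ t)
    where
    expand : ∀ a t → suc a * suc t ≡ suc (suc a * t + a)
    expand = solve-∀
  pascalˡ : binom (X + n₀) (p * t + p′) + binom (X + n₀) (p * suc t + 0) ≡ binom (X + suc n₀) (p * suc t + 0)
  pascalˡ = sym (trans (cong₂ binom (+-suc X n₀) borrow)
                       (cong (λ z → binom (X + n₀) (p * t + p′) + binom (X + n₀) z) (sym borrow)))
  lastDigit0 : binom X (p * t) * binom n₀ p′ + binom X (p * suc t) * 1 ≡ binom X (p * suc t) * 1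
  lastDigit0 = cong (_+ binom X (p * suc t) * 1) (trans (cong (binom X (p * t) *_) (binom-< n₀<p′)) (*-zeroʳ (binom X (p * t))))

slope : (ℕ → ℕ) → (ℕ → ℕ) → ℕ → ℕ
slope a c zero    = 0
slope a c (suc n) = c 0 * prod (a ∘ suc) n + a 0 * slope (a ∘ suc) (c ∘ suc) n

secondOrder : (ℕ → ℕ) → (ℕ → ℕ) → ℕ → ℕ → ℕ
secondOrder a c T zero    = 0
secondOrder a c T (suc n) =
  a 0 * secondOrder (a ∘ suc) (c ∘ suc) T n + c 0 * slope (a ∘ suc) (c ∘ suc) n + T * c 0 * secondOrder (a ∘ suc) (c ∘ suc) T n

prod-expand : ∀ (a c : ℕ → ℕ) T n → prod (λ i → a i + T * c i) n ≡ prod a n + T * slope a c n + T * T * secondOrder a c T n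
prod-expand a c T zero    = sym (simplify T)
  where
  simplify : ∀ T → 1 + T * 0 + T * T * 0 ≡ 1
  simplify = solve-∀
prod-expand a c T (suc n) = begin
  (a 0 + T * c 0) * prod (λ i → a (suc i) + T * c (suc i)) n
    ≡⟨ cong ((a 0 + T * c 0) *_) (prod-expand (a ∘ suc) (c ∘ suc) T n) ⟩
  (a 0 + T * c 0) * (prod (a ∘ suc) n + T * slope (a ∘ suc) (c ∘ suc) n + T * T * secondOrder (a ∘ suc) (c ∘ suc) T n)
    ≡⟨ collect (a 0) (c 0) T (prod (a ∘ suc) n) (slope (a ∘ suc) (c ∘ suc) n) (secondOrder (a ∘ suc) (c ∘ suc) T n) ⟩
  prod a (suc n) + T * slope a c (suc n) + T * T * secondOrder a c T (suc n) ∎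
  where
  collect : ∀ a c T P L W → (a + T * c) * (P + T * L + T * T * W) ≡ a * P + T * (c * P + a * L) + T * T * (a * W + c * L + T * c * W)
  collect = solve-∀

slope-cong : ∀ n {a a′ c c′ : ℕ → ℕ} → (∀ i → i < n → a i ≡ a′ i) → (∀ i → i < n → c i ≡ c′ i) → slope a c n ≡ slope a′ c′ n
slope-cong zero    ea ec = refl
slope-cong (suc n) ea ec =
  cong₂ _+_ (cong₂ _*_ (ec 0 z<s) (prod-cong n (λ i i<n → ea (suc i) (s<s i<n))))
            (cong₂ _*_ (ea 0 z<s) (slope-cong n (λ i i<n → ea (suc i) (s<s i<n)) (λ i i<n → ec (suc i) (s<s i<n))))

slope-mod : ∀ {M} n {a a′ : ℕ → ℕ} (c : ℕ → ℕ) → (∀ i → i < n → a i ≡ a′ i mod M) → slope a c n ≡ slope a′ c n mod M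
slope-mod zero    c ea = mod-refl 0
slope-mod (suc n) c ea =
  mod-+ (mod-*ˡ (c 0) (mod-prod n (λ i i<n → ea (suc i) (s<s i<n))))
        (mod-* (ea 0 z<s) (slope-mod n (c ∘ suc) (λ i i<n → ea (suc i) (s<s i<n))))

slope-scale : ∀ q n (l a c : ℕ → ℕ) → (∀ i → i < n → c i * q ≡ c i * l i) →
              q * slope (λ i → l i * a i) c n ≡ prod l n * slope a c n
slope-scale q zero    l a c h = *-zeroʳ q
slope-scale q (suc n) l a c h = begin
  q * (c 0 * prod la′ n + l 0 * a 0 * slope la′ (c ∘ suc) n)
    ≡⟨ distribute q (c 0) (prod la′ n) (l 0 * a 0) (slope la′ (c ∘ suc) n) ⟩
  c 0 * q * prod la′ n + l 0 * a 0 * (q * slope la′ (c ∘ suc) n)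
    ≡⟨ cong₂ (λ x y → x * prod la′ n + l 0 * a 0 * y) (h 0 z<s) (slope-scale q n (l ∘ suc) (a ∘ suc) (c ∘ suc) (λ i i<n → h (suc i) (s<s i<n))) ⟩
  c 0 * l 0 * prod la′ n + l 0 * a 0 * (prod (l ∘ suc) n * slope (a ∘ suc) (c ∘ suc) n)
    ≡⟨ cong (λ x → c 0 * l 0 * x + l 0 * a 0 * (prod (l ∘ suc) n * slope (a ∘ suc) (c ∘ suc) n)) (prod-* n (l ∘ suc) (a ∘ suc)) ⟩
  c 0 * l 0 * (prod (l ∘ suc) n * prod (a ∘ suc) n) + l 0 * a 0 * (prod (l ∘ suc) n * slope (a ∘ suc) (c ∘ suc) n)
    ≡⟨ factor (c 0) (l 0) (prod (l ∘ suc) n) (prod (a ∘ suc) n) (a 0) (slope (a ∘ suc) (c ∘ suc) n) ⟩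
  prod l (suc n) * slope a c (suc n) ∎
  where
  la′ = λ i → l (suc i) * a (suc i)
  distribute : ∀ q c P la L → q * (c * P + la * L) ≡ c * q * P + la * (q * L)
  distribute = solve-∀
  factor : ∀ c l Pl Pa a L → c * l * (Pl * Pa) + l * a * (Pl * L) ≡ l * Pl * (c * Pa + a * L)
  factor = solve-∀

-- The slope is the coefficient of T in the polynomial prod (a + T c); comparing both expansions
-- at a T exceeding both slopes shows it is invariant under permutations.
slope-permute : ∀ n (π : Permutation< n) (a c : ℕ → ℕ) →
                slope (a ∘ Permutation<.to π) (c ∘ Permutation<.to π) n ≡ slope a c n
slope-permute n π a c = begin
  L′              ≡⟨ m<n⇒m%n≡m {n = T} (s≤s (m≤n+m L′ L)) ⟨
  L′ % T          ≡⟨ [m+kn]%n≡m%n L′ W′ T ⟨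
  (L′ + W′ * T) % T ≡⟨ cong (_% T) same ⟩
  (L + W * T) % T ≡⟨ [m+kn]%n≡m%n L W T ⟩
  L % T           ≡⟨ m<n⇒m%n≡m {n = T} (s≤s (m≤m+n L L′)) ⟩
  L               ∎
  where
  open Permutation< π
  L = slope a c n
  L′ = slope (a ∘ to) (c ∘ to) n
  T = suc (L + L′)
  W = secondOrder a c T n
  W′ = secondOrder (a ∘ to) (c ∘ to) T n
  P = prod a n
  expansions : P + T * L′ + T * T * W′ ≡ P + T * L + T * T * W
  expansions = begin
    P + T * L′ + T * T * W′                 ≡⟨ cong (λ z → z + T * L′ + T * T * W′) (prod-permute n π a) ⟨
    prod (a ∘ to) n + T * L′ + T * T * W′   ≡⟨ prod-expand (a ∘ to) (c ∘ to) T n ⟨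
    prod (λ i → a (to i) + T * c (to i)) n  ≡⟨ prod-permute n π (λ i → a i + T * c i) ⟩
    prod (λ i → a i + T * c i) n            ≡⟨ prod-expand a c T n ⟩
    P + T * L + T * T * W                   ∎
  regroup : ∀ P T L W → P + T * L + T * T * W ≡ P + T * (L + W * T)
  regroup = solve-∀
  same : L′ + W′ * T ≡ L + W * T
  same = *-cancelˡ-≡ _ _ T (+-cancelˡ-≡ P _ _ (trans (sym (regroup P T L′ W′)) (trans expansions (regroup P T L W))))

ifZero : ℕ → ℕ → ℕ → ℕ
ifZero zero    a b = a
ifZero (suc _) a b = b

ifZero-0 : ∀ {r} a b → r ≡ 0 → ifZero r a b ≡ a
ifZero-0 a b refl = refl

ifZero-≢0 : ∀ {r} a b → r ≢ 0 → ifZero r a b ≡ b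
ifZero-≢0 {zero}  a b r≢0 = ⊥-elim (r≢0 refl)
ifZero-≢0 {suc r} a b _   = refl

ifZero-swap-* : ∀ r v → ifZero r v 1 * ifZero r 1 v ≡ v
ifZero-swap-* zero    v = *-identityʳ v
ifZero-swap-* (suc r) v = +-identityʳ v

unitFactor : (p : ℕ) → .{{NonZero p}} → ℕ → ℕ → ℕ
unitFactor p z i = ifZero (suc i % p) 1 (z + suc i)

nonunitFactor : (p : ℕ) → .{{NonZero p}} → ℕ → ℕ → ℕ
nonunitFactor p z i = ifZero (suc i % p) (z + suc i) 1

unitProd : (p : ℕ) → .{{NonZero p}} → ℕ → ℕ → ℕ
unitProd p z n = prod (unitFactor p z) n

risingFrom : ℕ → ℕ → ℕ
risingFrom x y = prod (λ i → x + suc i) y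

binom*risingFrom0 : ∀ x y → binom (x + y) y * risingFrom 0 y ≡ risingFrom x y
binom*risingFrom0 x zero    = refl
binom*risingFrom0 x (suc y) = begin
  binom (x + suc y) (suc y) * risingFrom 0 (suc y)
    ≡⟨ cong₂ _*_ (cong (λ z → binom z (suc y)) (+-suc x y)) (prod-init-last y suc) ⟩
  binom (suc (x + y)) (suc y) * (risingFrom 0 y * suc y) ≡⟨ swap (binom (suc (x + y)) (suc y)) (risingFrom 0 y) (suc y) ⟩
  binom (suc (x + y)) (suc y) * suc y * risingFrom 0 y   ≡⟨ cong (_* risingFrom 0 y) (binom-absorb (x + y) y) ⟩
  suc (x + y) * binom (x + y) y * risingFrom 0 y         ≡⟨ *-assoc (suc (x + y)) (binom (x + y) y) (risingFrom 0 y) ⟩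
  suc (x + y) * (binom (x + y) y * risingFrom 0 y)       ≡⟨ cong (suc (x + y) *_) (binom*risingFrom0 x y) ⟩
  suc (x + y) * risingFrom x y                           ≡⟨ *-comm _ (risingFrom x y) ⟩
  risingFrom x y * suc (x + y)                           ≡⟨ cong (risingFrom x y *_) (sym (+-suc x y)) ⟩
  risingFrom x y * (x + suc y)                           ≡⟨ prod-init-last y (λ i → x + suc i) ⟨
  risingFrom x (suc y)                                   ∎
  where
  swap : ∀ a b c → a * (b * c) ≡ a * c * b
  swap = solve-∀

risingFrom-units : ∀ p .{{_ : NonZero p}} z n → risingFrom z n ≡ prod (nonunitFactor p z) n * unitProd p z n
risingFrom-units p z n = trans (prod-cong n (λ i _ → sym (ifZero-swap-* (suc i % p) (z + suc i))))
                              (prod-* n (nonunitFactor p z) (unitFactor p z))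

prod-nonunitFactor-block : ∀ p′ z t → prod (λ i → nonunitFactor (suc p′) z (t * suc p′ + i)) (suc p′) ≡ z + suc t * suc p′
prod-nonunitFactor-block p′ z t = begin
  prod F (suc p′)          ≡⟨ prod-init-last p′ F ⟩
  prod F p′ * F p′          ≡⟨ cong₂ _*_ (trans (prod-cong p′ unit) (trans (prod-const p′ 1) (^-zeroˡ p′))) last ⟩
  1 * (z + suc t * p)      ≡⟨ *-identityˡ _ ⟩
  z + suc t * p            ∎
  where
  p = suc p′
  F = λ i → nonunitFactor p z (t * p + i)
  unit : ∀ i → i < p′ → F i ≡ 1
  unit i i<p′ = cong (λ r → ifZero r (z + suc (t * p + i)) 1)
    (trans (cong (λ x → suc x % p) (+-comm (t * p) i)) (trans ([m+kn]%n≡m%n (suc i) t p) (m<n⇒m%n≡m (s<s i<p′))))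
  multiple : suc (t * p + p′) ≡ suc t * p
  multiple = trans (sym (+-suc (t * p) p′)) (+-comm (t * p) p)
  last : F p′ ≡ z + suc t * p
  last = trans (cong (λ r → ifZero r (z + suc (t * p + p′)) 1) (trans (cong (_% p) multiple) (m*n%n≡0 (suc t) p)))
               (cong (z +_) multiple)

prod-nonunitFactor : ∀ p′ c b → prod (nonunitFactor (suc p′) (c * suc p′)) (b * suc p′) ≡ suc p′ ^ b * risingFrom c b
prod-nonunitFactor p′ c b = begin
  prod (nonunitFactor p (c * p)) (b * p)          ≡⟨ prod-blocks b p (nonunitFactor p (c * p)) ⟩
  prod (λ t → prod (λ i → nonunitFactor p (c * p) (t * p + i)) p) b ≡⟨ prod-cong b (λ t _ → prod-nonunitFactor-block p′ (c * p) t) ⟩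
  prod (λ t → c * p + suc t * p) b                ≡⟨ prod-cong b (λ t _ → factor c t p) ⟩
  prod (λ t → p * (c + suc t)) b                  ≡⟨ prod-* b (λ _ → p) (λ t → c + suc t) ⟩
  prod (λ _ → p) b * risingFrom c b               ≡⟨ cong (_* risingFrom c b) (prod-const b p) ⟩
  p ^ b * risingFrom c b                          ∎
  where
  p = suc p′
  factor : ∀ c t p → c * p + suc t * p ≡ p * (c + suc t)
  factor = solve-∀

binom-p*-unitProd : ∀ p′ c b → let p = suc p′ in
  binom (c * p + b * p) (b * p) * unitProd p 0 (b * p) ≡ binom (c + b) b * unitProd p (c * p) (b * p)
binom-p*-unitProd p′ c b = *-cancelˡ-≡ _ _ K {{>-nonZero K-positive}} (begin
  K * (binom (c * p + b * p) (b * p) * U₀)            ≡⟨ shuffle (p ^ b) (risingFrom 0 b) (binom (c * p + b * p) (b * p)) U₀ ⟩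
  binom (c * p + b * p) (b * p) * (K * U₀)            ≡⟨ cong (binom (c * p + b * p) (b * p) *_) (sym (units 0)) ⟩
  binom (c * p + b * p) (b * p) * risingFrom 0 (b * p) ≡⟨ binom*risingFrom0 (c * p) (b * p) ⟩
  risingFrom (c * p) (b * p)                         ≡⟨ units c ⟩
  p ^ b * risingFrom c b * Uc                        ≡⟨ cong (λ z → p ^ b * z * Uc) (sym (binom*risingFrom0 c b)) ⟩
  p ^ b * (binom (c + b) b * risingFrom 0 b) * Uc    ≡⟨ shuffle′ (p ^ b) (risingFrom 0 b) (binom (c + b) b) Uc ⟩
  K * (binom (c + b) b * Uc)                         ∎)
  where
  p = suc p′
  K = p ^ b * risingFrom 0 b
  U₀ = unitProd p 0 (b * p)
  Uc = unitProd p (c * p) (b * p)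
  K-positive : 0 < K
  K-positive = *-mono-< (m^n>0 p b) (prod-positive b suc (λ _ _ → z<s))
  units : ∀ c → risingFrom (c * p) (b * p) ≡ p ^ b * risingFrom c b * unitProd p (c * p) (b * p)
  units c = trans (risingFrom-units p (c * p) (b * p)) (cong (_* unitProd p (c * p) (b * p)) (prod-nonunitFactor p′ c b))
  shuffle : ∀ a d x q → a * d * (x * q) ≡ x * (a * d * q)
  shuffle = solve-∀
  shuffle′ : ∀ a d x q → a * (x * d) * q ≡ a * d * (x * q)
  shuffle′ = solve-∀

module _ (M : ℕ) where

  private
    N : ℕ
    N = suc M

  -- Indices i < M stand for the residues i + 1 ∈ [1, N).
  scaleIndex : ℕ → ℕ → ℕ
  scaleIndex A i = (A * suc i) % N ∸ 1

  module _ {A B : ℕ} (B*A≡1 : B * A ≡ 1 mod suc M) where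

    private
      unscale : ∀ i → i < M → (B * ((A * suc i) % N)) % N ≡ suc i
      unscale i i<M = trans (mod⇒ModEq undo) (m<n⇒m%n≡m (s<s i<M))
        where
        undo : B * ((A * suc i) % N) ≡ suc i mod N
        undo = mod-trans (mod-*ˡ B (%≡mod (A * suc i)))
                 (mod-resp (*-assoc B A (suc i)) (*-identityˡ (suc i)) (mod-* B*A≡1 (mod-refl (suc i))))

      suc-scaleIndex : ∀ i → i < M → suc (scaleIndex A i) ≡ (A * suc i) % N
      suc-scaleIndex i i<M with (A * suc i) % N in eq
      ... | suc _ = refl
      ... | zero  = ⊥-elim (0≢1+n (begin
        0                              ≡⟨ cong (_% N) (*-zeroʳ B) ⟨
        (B * 0) % N                    ≡⟨ cong (λ x → (B * x) % N) eq ⟨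
        (B * ((A * suc i) % N)) % N    ≡⟨ unscale i i<M ⟩
        suc i                          ∎))

    scaleIndex-mod : ∀ i → i < M → suc (scaleIndex A i) ≡ A * suc i mod N
    scaleIndex-mod i i<M = mod-resp (sym (suc-scaleIndex i i<M)) refl (%≡mod (A * suc i))

    scaleIndex-< : ∀ i → i < M → scaleIndex A i < M
    scaleIndex-< i i<M = s<s⁻¹ (subst (_< N) (sym (suc-scaleIndex i i<M)) (m%n<n (A * suc i) N))

    scaleIndex-inverse : ∀ i → i < M → scaleIndex B (scaleIndex A i) ≡ i
    scaleIndex-inverse i i<M = cong (_∸ 1) (trans (cong (λ x → (B * x) % N) (suc-scaleIndex i i<M)) (unscale i i<M))

  scaling : ∀ {A B} → B * A ≡ 1 mod suc M → A * B ≡ 1 mod suc M → Permutation< M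
  scaling {A} {B} B*A≡1 A*B≡1 = record
    { to      = scaleIndex A
    ; from    = scaleIndex B
    ; to-<    = scaleIndex-< {A} {B} B*A≡1
    ; from-<  = scaleIndex-< {B} {A} A*B≡1
    ; from-to = scaleIndex-inverse {A} {B} B*A≡1
    ; to-from = scaleIndex-inverse {B} {A} A*B≡1
    }

half-inverse : ∀ N .{{_ : NonZero N}} → 2 ∤ N → suc (N / 2) * 2 ≡ 1 mod N
half-inverse N 2∤N = ≡+*⇒mod 1 (begin
  suc (N / 2) * 2          ≡⟨ regroup (N / 2) ⟩
  1 + (1 + N / 2 * 2)      ≡⟨ cong (λ r → 1 + (r + N / 2 * 2)) N%2≡1 ⟨
  1 + (N % 2 + N / 2 * 2)  ≡⟨ cong (1 +_) (m≡m%n+[m/n]*n N 2) ⟨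
  1 + N                    ≡⟨ cong (1 +_) (sym (+-identityʳ N)) ⟩
  1 + 1 * N                ∎)
  where
  regroup : ∀ h → suc h * 2 ≡ 1 + (1 + h * 2)
  regroup = solve-∀
  N%2≡1 : N % 2 ≡ 1
  N%2≡1 with N % 2 in eq | m%n<n N 2
  ... | 0 | _ = ⊥-elim (2∤N (m%n≡0⇒n∣m N 2 eq))
  ... | 1 | _ = refl
  ... | suc (suc _) | s<s (s<s ())

module UnitProducts (p′ j : ℕ) (pp : Prime (suc p′)) where

  p : ℕ
  p = suc p′

  M : ℕ
  M = p ^ suc j ∸ 1

  N : ℕ
  N = suc M

  N≡p^[1+j] : N ≡ p ^ suc j
  N≡p^[1+j] = suc-pred (p ^ suc j) {{m^n≢0 p (suc j)}}

  N≡p^j*p : N ≡ p ^ j * p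
  N≡p^j*p = trans N≡p^[1+j] (*-comm p (p ^ j))

  p∣N : p ∣ N
  p∣N = divides (p ^ j) N≡p^j*p

  N*N≡p^ : N * N ≡ p ^ (suc j + suc j)
  N*N≡p^ = trans (cong₂ _*_ N≡p^[1+j] N≡p^[1+j]) (sym (^-distribˡ-+-* p (suc j) (suc j)))

  U : ℕ → ℕ
  U w = unitProd p w M

  unitProd-N : ∀ w → unitProd p w N ≡ U w
  unitProd-N w = trans (prod-init-last M (unitFactor p w)) (trans (cong (U w *_) last) (*-identityʳ _))
    where
    last : unitFactor p w M ≡ 1
    last = cong (λ r → ifZero r 1 (w + suc M)) (trans (cong (_% p) N≡p^j*p) (m*n%n≡0 (p ^ j) p))

  shiftCoeff : ℕ → ℕ → ℕ
  shiftCoeff s i = ifZero (suc i % p) 0 s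

  V : ℕ → ℕ
  V s = slope (unitFactor p 0) (shiftCoeff s) M + N * secondOrder (unitFactor p 0) (shiftCoeff s) N M

  U-shift : ∀ s → U (s * N) ≡ U 0 + N * V s
  U-shift s = begin
    U (s * N)                                                ≡⟨ prod-cong M (λ i _ → factor-shift (suc i % p) (suc i)) ⟩
    prod (λ i → unitFactor p 0 i + N * shiftCoeff s i) M      ≡⟨ prod-expand (unitFactor p 0) (shiftCoeff s) N M ⟩
    U 0 + N * slope (unitFactor p 0) (shiftCoeff s) M + N * N * secondOrder (unitFactor p 0) (shiftCoeff s) N M
      ≡⟨ regroup (U 0) N (slope (unitFactor p 0) (shiftCoeff s) M) (secondOrder (unitFactor p 0) (shiftCoeff s) N M) ⟩
    U 0 + N * V s                                            ∎
    where
    factor-shift : ∀ r u → ifZero r 1 (s * N + u) ≡ ifZero r 1 (0 + u) + N * ifZero r 0 s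
    factor-shift zero    u = sym (cong suc (*-zeroʳ N))
    factor-shift (suc r) u = trans (+-comm (s * N) u) (cong (u +_) (*-comm s N))
    regroup : ∀ y N l w → y + N * l + N * N * w ≡ y + N * (l + N * w)
    regroup = solve-∀

  complement : ∀ i → i < M → suc i + suc (M ∸ suc i) ≡ N
  complement i i<M = trans (+-suc (suc i) (M ∸ suc i)) (cong suc (m+[n∸m]≡n i<M))

  complement-residue : ∀ u v → u + v ≡ N → u % p ≡ 0 → v % p ≡ 0
  complement-residue u v u+v≡N u%p≡0 =
    n∣m⇒m%n≡0 v p (∣m+n∣m⇒∣n (subst (p ∣_) (sym u+v≡N) p∣N) (m%n≡0⇒n∣m u p u%p≡0))

  pairFactor : ℕ → ℕ
  pairFactor i = unitFactor p 0 i * unitFactor p 0 (M ∸ suc i)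

  unitIndicator : ℕ → ℕ
  unitIndicator i = ifZero (suc i % p) 0 1

  T : ℕ → ℕ
  T s = s * suc s * (N * N)

  L : ℕ
  L = slope pairFactor unitIndicator M

  W₂ : ℕ → ℕ
  W₂ s = secondOrder pairFactor unitIndicator (T s) M

  U*U : ∀ w → U w * U w ≡ prod (λ i → unitFactor p w i * unitFactor p w (M ∸ suc i)) M
  U*U w = trans (cong (U w *_) (prod-reverse M (unitFactor p w))) (sym (prod-* M (unitFactor p w) (λ i → unitFactor p w (M ∸ suc i))))

  pair-shift : ∀ r₁ r₂ u v s → (r₁ ≡ 0 → r₂ ≡ 0) → (r₂ ≡ 0 → r₁ ≡ 0) → u + v ≡ N →
               ifZero r₁ 1 (s * N + u) * ifZero r₂ 1 (s * N + v) ≡ ifZero r₁ 1 (0 + u) * ifZero r₂ 1 (0 + v) + T s * ifZero r₁ 0 1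
  pair-shift zero      zero      u v s _ _ _ = sym (cong suc (*-zeroʳ (T s)))
  pair-shift zero      (suc r₂) u v s only₁ _ _ with only₁ refl
  ... | ()
  pair-shift (suc r₁) zero      u v s _ only₂ _ with only₂ refl
  ... | ()
  pair-shift (suc r₁) (suc r₂) u v s _ _ u+v≡N = begin
    (s * N + u) * (s * N + v)                          ≡⟨ cong (λ z → (s * z + u) * (s * z + v)) (sym u+v≡N) ⟩
    (s * (u + v) + u) * (s * (u + v) + v)              ≡⟨ expand s u v ⟩
    u * v + s * suc s * ((u + v) * (u + v)) * 1        ≡⟨ cong (λ z → u * v + s * suc s * (z * z) * 1) u+v≡N ⟩
    u * v + T s * 1                                    ∎
    where
    expand : ∀ s u v → (s * (u + v) + u) * (s * (u + v) + v) ≡ u * v + s * suc s * ((u + v) * (u + v)) * 1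
    expand = solve-∀

  U*U-shift : ∀ s → U (s * N) * U (s * N) ≡ U 0 * U 0 + T s * L + T s * T s * W₂ s
  U*U-shift s = begin
    U (s * N) * U (s * N)                                              ≡⟨ U*U (s * N) ⟩
    prod (λ i → unitFactor p (s * N) i * unitFactor p (s * N) (M ∸ suc i)) M ≡⟨ prod-cong M pair ⟩
    prod (λ i → pairFactor i + T s * unitIndicator i) M                ≡⟨ prod-expand pairFactor unitIndicator (T s) M ⟩
    prod pairFactor M + T s * L + T s * T s * W₂ s                     ≡⟨ cong (λ z → z + T s * L + T s * T s * W₂ s) (U*U 0) ⟨
    U 0 * U 0 + T s * L + T s * T s * W₂ s                             ∎
    where
    pair : ∀ i → i < M → unitFactor p (s * N) i * unitFactor p (s * N) (M ∸ suc i) ≡ pairFactor i + T s * unitIndicator i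
    pair i i<M = pair-shift (suc i % p) (suc (M ∸ suc i) % p) (suc i) (suc (M ∸ suc i)) s
      (complement-residue (suc i) (suc (M ∸ suc i)) (complement i i<M))
      (complement-residue (suc (M ∸ suc i)) (suc i) (trans (+-comm _ (suc i)) (complement i i<M)))
      (complement i i<M)

  shift-identity : ∀ s → N * V s * (2 * U 0 + N * V s) ≡ T s * (L + T s * W₂ s)
  shift-identity s = +-cancelˡ-≡ (U 0 * U 0) _ _ (begin
    U 0 * U 0 + N * V s * (2 * U 0 + N * V s) ≡⟨ square (U 0) (N * V s) ⟩
    (U 0 + N * V s) * (U 0 + N * V s)         ≡⟨ cong (λ z → z * z) (U-shift s) ⟨
    U (s * N) * U (s * N)                     ≡⟨ U*U-shift s ⟩
    U 0 * U 0 + T s * L + T s * T s * W₂ s    ≡⟨ regroup (U 0 * U 0) (T s) L (W₂ s) ⟩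
    U 0 * U 0 + T s * (L + T s * W₂ s)        ∎)
    where
    square : ∀ y x → y * y + x * (2 * y + x) ≡ (y + x) * (y + x)
    square = solve-∀
    regroup : ∀ a t l w → a + t * l + t * t * w ≡ a + t * (l + t * w)
    regroup = solve-∀

  p∤unitFactor0 : ∀ i → p ∤ unitFactor p 0 i
  p∤unitFactor0 i with suc i % p in eq
  ... | zero  = prime∤1 pp
  ... | suc r = λ p∣1+i → 0≢1+n (trans (sym (n∣m⇒m%n≡0 (suc i) p p∣1+i)) eq)

  p∤U0 : p ∤ U 0
  p∤U0 = prime∤prod pp M (unitFactor p 0) (λ i _ → p∤unitFactor0 i)

  ∣⇒unitProd-shift : ∀ e s → p ^ e ∣ N * V s → unitProd p (s * N) N ≡ unitProd p 0 N mod p ^ e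
  ∣⇒unitProd-shift e s (divides q eq) =
    mod-resp (sym (unitProd-N (s * N))) (sym (unitProd-N 0)) (≡+*⇒mod q (trans (U-shift s) (cong (U 0 +_) eq)))

  p∤2U0+NV : 3 ≤ p → ∀ s → p ∤ 2 * U 0 + N * V s
  p∤2U0+NV 3≤p s p∣ with euclidsLemma 2 (U 0) pp (∣m+n∣m⇒∣n (subst (p ∣_) (+-comm _ (N * V s)) p∣) (∣m⇒∣m*n (V s) p∣N))
  ... | inj₁ p∣2  = <⇒≱ 3≤p (∣⇒≤ p∣2)
  ... | inj₂ p∣U0 = p∤U0 p∣U0

  ∣T[L+TW₂]⇒∣NV : 3 ≤ p → ∀ e s → p ^ e ∣ T s * (L + T s * W₂ s) → p ^ e ∣ N * V s
  ∣T[L+TW₂]⇒∣NV 3≤p e s p^e∣ = prime^∣*-cancelˡ pp (p∤2U0+NV 3≤p s) e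
    (subst (p ^ e ∣_) (trans (sym (shift-identity s)) (*-comm (N * V s) _)) p^e∣)

  unitProd-shift-odd : 3 ≤ p → ∀ s → unitProd p (s * N) N ≡ unitProd p 0 N mod p ^ (suc j + suc j)
  unitProd-shift-odd 3≤p s = ∣⇒unitProd-shift (suc j + suc j) s (∣T[L+TW₂]⇒∣NV 3≤p (suc j + suc j) s
    (∣m⇒∣m*n (L + T s * W₂ s) (∣n⇒∣m*n (s * suc s) (subst (_∣ N * N) N*N≡p^ ∣-refl))))

  unitProd-shift-N∣L : 3 ≤ p → N ∣ L → ∀ s → unitProd p (s * N) N ≡ unitProd p 0 N mod p ^ (suc j + suc j + suc j)
  unitProd-shift-N∣L 3≤p N∣L s = ∣⇒unitProd-shift E s (∣T[L+TW₂]⇒∣NV 3≤p E s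
    (subst (_∣ T s * (L + T s * W₂ s)) N³≡p^ (*-pres-∣ (∣n⇒∣m*n (s * suc s) ∣-refl) (∣m∣n⇒∣m+n N∣L (∣m⇒∣m*n (W₂ s) N∣T)))))
    where
    E = suc j + suc j + suc j
    N³≡p^ : N * N * N ≡ p ^ E
    N³≡p^ = trans (cong₂ _*_ N*N≡p^ N≡p^[1+j]) (sym (^-distribˡ-+-* p (suc j + suc j) (suc j)))
    N∣T : N ∣ T s
    N∣T = ∣n⇒∣m*n (s * suc s) (∣m⇒∣m*n N ∣-refl)

  unitFactor-periodic : ∀ z t i → unitFactor p z (t * N + i) ≡ unitFactor p (z + t * N) i
  unitFactor-periodic z t i = cong₂ (λ r → ifZero r 1) (trans (cong (_% p) residue) ([m+kn]%n≡m%n (suc i) (t * p ^ j) p)) (regroup z t N i)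
    where
    residue : suc (t * N + i) ≡ suc i + t * p ^ j * p
    residue = trans (cong suc (+-comm (t * N) i)) (cong (suc i +_) (trans (cong (t *_) N≡p^j*p) (sym (*-assoc t (p ^ j) p))))
    regroup : ∀ z t N i → z + suc (t * N + i) ≡ z + t * N + suc i
    regroup = solve-∀

  unitProd-blocks : ∀ z m → unitProd p z (m * N) ≡ prod (λ t → unitProd p (z + t * N) N) m
  unitProd-blocks z m = trans (prod-blocks m N (unitFactor p z)) (prod-cong m (λ t _ → prod-cong N (λ i _ → unitFactor-periodic z t i)))

  module _ (E : ℕ) (shift : ∀ s → unitProd p (s * N) N ≡ unitProd p 0 N mod p ^ E) where

    unitProd-shift-blocks : ∀ c m → unitProd p (c * N) (m * N) ≡ unitProd p 0 (m * N) mod p ^ E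
    unitProd-shift-blocks c m = mod-resp (sym (unitProd-blocks (c * N) m)) (sym (unitProd-blocks 0 m))
      (mod-trans (mod-prod m (λ t _ → mod-resp (cong (λ w → unitProd p w N) (*-distribʳ-+ N c t)) refl (shift (c + t))))
                 (mod-sym (mod-prod m (λ t _ → shift t))))

    binom-step : ∀ n m → binom (n * p ^ suc j) (m * p ^ suc j) ≡ binom (n * p ^ j) (m * p ^ j) mod p ^ E
    binom-step n m with m ≤? n
    ... | no m≰n = mod-resp (sym (binom-< (scaled (suc j)))) (sym (binom-< (scaled j))) (mod-refl 0)
      where
      scaled : ∀ e → n * p ^ e < m * p ^ e
      scaled e = *-monoˡ-< (p ^ e) {{>-nonZero (m^n>0 p e)}} (≰⇒> m≰n)
    ... | yes m≤n = mod-cancelˡ pp (prime∤prod pp (b * p) (unitFactor p 0) (λ i _ → p∤unitFactor0 i)) E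
      (mod-resp lhs rhs (mod-*ˡ (binom (c′ + b) b) shifted))
      where
      c = n ∸ m
      c′ = c * p ^ j
      b = m * p ^ j
      U₀ = unitProd p 0 (b * p)
      ^-suc : ∀ x → x * p ^ j * p ≡ x * p ^ suc j
      ^-suc x = trans (*-assoc x (p ^ j) p) (cong (x *_) (*-comm (p ^ j) p))
      c′+b : c′ + b ≡ n * p ^ j
      c′+b = trans (sym (*-distribʳ-+ (p ^ j) c m)) (cong (_* p ^ j) (m∸n+n≡m m≤n))
      c′*p+b*p : c′ * p + b * p ≡ n * p ^ suc j
      c′*p+b*p = trans (sym (*-distribʳ-+ p c′ b)) (trans (cong (_* p) c′+b) (^-suc n))
      shifted : unitProd p (c′ * p) (b * p) ≡ U₀ mod p ^ E
      shifted = mod-resp (cong₂ (unitProd p) (trans (cong (c *_) N≡p^j*p) (sym (*-assoc c (p ^ j) p))) (sym b*p))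
                         (cong (unitProd p 0) (sym b*p)) (unitProd-shift-blocks c m)
        where
        b*p : b * p ≡ m * N
        b*p = trans (*-assoc m (p ^ j) p) (cong (m *_) (sym N≡p^j*p))
      lhs : binom (c′ + b) b * unitProd p (c′ * p) (b * p) ≡ U₀ * binom (n * p ^ suc j) (m * p ^ suc j)
      lhs = trans (sym (binom-p*-unitProd p′ c′ b)) (trans (cong₂ (λ x y → binom x y * U₀) c′*p+b*p (^-suc m)) (*-comm _ U₀))
      rhs : binom (c′ + b) b * U₀ ≡ U₀ * binom (n * p ^ j) (m * p ^ j)
      rhs = trans (cong (λ x → binom x b * U₀) c′+b) (*-comm _ U₀)

2∣n*[1+n] : ∀ n → 2 ∣ n * suc n
2∣n*[1+n] zero    = _ ∣0
2∣n*[1+n] (suc n) with 2∣n*[1+n] n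
... | divides q eq = divides (q + suc n) (trans (expand n) (trans (cong (_+ 2 * suc n) eq) (regroup q n)))
  where
  expand : ∀ n → suc n * suc (suc n) ≡ n * suc n + 2 * suc n
  expand = solve-∀
  regroup : ∀ q n → q * 2 + 2 * suc n ≡ (q + suc n) * 2
  regroup = solve-∀

unitProd-shift-2 : ∀ j s → let open UnitProducts 1 j prime[2] in
                   unitProd 2 (s * N) N ≡ unitProd 2 0 N mod 2 ^ (suc j + j)
unitProd-shift-2 zero    s = ∣⇒unitProd-shift 1 s (∣m⇒∣m*n (V s) ∣-refl)
  where open UnitProducts 1 0 prime[2]
unitProd-shift-2 (suc i) s = ∣⇒unitProd-shift (suc j + j) s
  (∣-trans (^-monoʳ-∣ 2 (+-monoʳ-≤ (suc j) (n≤1+n j)))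
           (prime^∣*-cancelˡ prime[2] 2∤U0+HV (suc j + suc j) (subst (2 ^ (suc j + suc j) ∣_) (*-comm (N * V s) _) 2^∣NV[U0+HV])))
  where
  j = suc i
  open UnitProducts 1 j prime[2]
  H = 2 ^ j
  halve : N * V s * (2 * U 0 + N * V s) ≡ 2 * (N * V s * (U 0 + H * V s))
  halve = trans (cong (λ z → N * V s * (2 * U 0 + z * V s)) N≡p^[1+j]) (regroup (N * V s) (U 0) H (V s))
    where
    regroup : ∀ a y h v → a * (2 * y + 2 * h * v) ≡ 2 * (a * (y + h * v))
    regroup = solve-∀
  2^∣NV[U0+HV] : 2 ^ (suc j + suc j) ∣ N * V s * (U 0 + H * V s)
  2^∣NV[U0+HV] = subst (_∣ N * V s * (U 0 + H * V s)) N*N≡p^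
    (*-cancelˡ-∣ 2 (subst (2 * (N * N) ∣_) (trans (sym (shift-identity s)) halve)
                                          (∣m⇒∣m*n (L + T s * W₂ s) (*-pres-∣ (2∣n*[1+n] s) ∣-refl))))
  2∤U0+HV : 2 ∤ U 0 + H * V s
  2∤U0+HV 2∣U0+HV = p∤U0 (∣m+n∣m⇒∣n (subst (2 ∣_) (+-comm (U 0) (H * V s)) 2∣U0+HV) (∣m⇒∣m*n (V s) (∣m⇒∣m*n (2 ^ i) ∣-refl)))

-- For p ≥ 5, doubling permutes the residues 1 ≤ i < N.  It maps the pair product i (N - i) ≡ - i²
-- to 4 i (N - i), so comparing slopes gives 4 L ≡ L, i.e. N ∣ 3 L.
module SlopeDivisibility (p′ j : ℕ) (pp : Prime (suc p′)) (5≤p : 5 ≤ suc p′) where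
  open UnitProducts p′ j pp

  p∤2 : p ∤ 2
  p∤2 p∣2 = <⇒≱ (≤-trans (m≤m+n 3 2) 5≤p) (∣⇒≤ p∣2)

  p∤3 : p ∤ 3
  p∤3 p∣3 = <⇒≱ (≤-trans (m≤m+n 4 1) 5≤p) (∣⇒≤ p∣3)

  2∤N : 2 ∤ N
  2∤N 2∣N = prime∤prod prime[2] (suc j) (λ _ → p) (λ _ _ → 2∤p) (subst (2 ∣_) (trans N≡p^[1+j] (sym (prod-const (suc j) p))) 2∣N)
    where
    2∤p : 2 ∤ p
    2∤p 2∣p with prime⇒coprime pp (≤-trans (m≤m+n 3 2) 5≤p) (2∣p , ∣-refl)
    ... | ()

  H : ℕ
  H = suc (N / 2)

  H*2≡1 : H * 2 ≡ 1 mod N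
  H*2≡1 = half-inverse N 2∤N

  doubling : Permutation< M
  doubling = scaling M {2} {H} H*2≡1 (mod-resp (*-comm H 2) refl H*2≡1)

  σ : ℕ → ℕ
  σ = scaleIndex M 2

  mod-N⇒%p : ∀ {a b} → a ≡ b mod N → a % p ≡ b % p
  mod-N⇒%p a≡b = mod⇒ModEq (mod-weaken p∣N a≡b)

  double-residue : ∀ i → i < M → suc (σ i) % p ≡ (2 * suc i) % p
  double-residue i i<M = mod-N⇒%p (scaleIndex-mod M {2} {H} H*2≡1 i i<M)

  double-multiple : ∀ i → i < M → suc (σ i) % p ≡ 0 → suc i % p ≡ 0
  double-multiple i i<M σ%p≡0 with euclidsLemma 2 (suc i) pp (m%n≡0⇒n∣m (2 * suc i) p (trans (sym (double-residue i i<M)) σ%p≡0))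
  ... | inj₁ p∣2   = ⊥-elim (p∤2 p∣2)
  ... | inj₂ p∣1+i = n∣m⇒m%n≡0 (suc i) p p∣1+i

  multiple-double : ∀ i → i < M → suc i % p ≡ 0 → suc (σ i) % p ≡ 0
  multiple-double i i<M i%p≡0 =
    trans (double-residue i i<M) (n∣m⇒m%n≡0 (2 * suc i) p (∣n⇒∣m*n 2 (m%n≡0⇒n∣m (suc i) p i%p≡0)))

  complement-multiple : ∀ i → i < M → suc (M ∸ suc i) % p ≡ 0 → suc i % p ≡ 0
  complement-multiple i i<M = complement-residue (suc (M ∸ suc i)) (suc i) (trans (+-comm _ (suc i)) (complement i i<M))

  multiple-complement : ∀ i → i < M → suc i % p ≡ 0 → suc (M ∸ suc i) % p ≡ 0
  multiple-complement i i<M = complement-residue (suc i) (suc (M ∸ suc i)) (complement i i<M)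

  unitIndicator-σ : ∀ i → i < M → unitIndicator (σ i) ≡ unitIndicator i
  unitIndicator-σ i i<M with suc i % p ≟ 0
  ... | yes i%p≡0 = trans (ifZero-0 0 1 (multiple-double i i<M i%p≡0)) (sym (ifZero-0 0 1 i%p≡0))
  ... | no  i%p≢0 = trans (ifZero-≢0 0 1 (i%p≢0 ∘ double-multiple i i<M)) (sym (ifZero-≢0 0 1 i%p≢0))

  scale : ℕ → ℕ
  scale i = ifZero (suc i % p) 1 4

  pairFactor-σ : ∀ i → i < M → pairFactor (σ i) ≡ scale i * pairFactor i mod N
  pairFactor-σ i i<M with suc i % p ≟ 0
  ... | yes i%p≡0 = mod-resp
    (sym (cong₂ _*_ (ifZero-0 1 _ (multiple-double i i<M i%p≡0))
                    (ifZero-0 1 _ (multiple-complement (σ i) σi<M (multiple-double i i<M i%p≡0)))))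
    (sym (cong₂ _*_ (ifZero-0 1 4 i%p≡0) (cong₂ _*_ (ifZero-0 1 _ i%p≡0) (ifZero-0 1 _ (multiple-complement i i<M i%p≡0)))))
    (mod-refl 1)
    where
    σi<M = scaleIndex-< M {2} {H} H*2≡1 i i<M
  ... | no i%p≢0 = mod-resp
    (sym (cong₂ _*_ (ifZero-≢0 1 _ σi%p≢0) (ifZero-≢0 1 _ (σi%p≢0 ∘ complement-multiple (σ i) σi<M))))
    (sym (cong₂ _*_ (ifZero-≢0 1 4 i%p≢0) (cong₂ _*_ (ifZero-≢0 1 _ i%p≢0) (ifZero-≢0 1 _ (i%p≢0 ∘ complement-multiple i i<M)))))
    (mod-+-cancelʳ (2 * u * (2 * u)) (mod-trans σ-side (mod-sym i-side)))
    where
    σi<M = scaleIndex-< M {2} {H} H*2≡1 i i<M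
    σi%p≢0 : suc (σ i) % p ≢ 0
    σi%p≢0 = i%p≢0 ∘ double-multiple i i<M
    u = suc i
    v = suc (M ∸ suc i)
    w = suc (σ i)
    w′ = suc (M ∸ suc (σ i))
    w≡2u : w ≡ 2 * u mod N
    w≡2u = scaleIndex-mod M {2} {H} H*2≡1 i i<M
    σ-side : w * w′ + 2 * u * (2 * u) ≡ 0 mod N
    σ-side = mod-trans (mod-+ (mod-refl (w * w′)) (mod-* (mod-sym w≡2u) (mod-sym w≡2u))) (complement-* w w′ (complement (σ i) σi<M))
    i-side : 4 * (u * v) + 2 * u * (2 * u) ≡ 0 mod N
    i-side = mod-resp (sym (regroup u v)) refl (mod-*ˡ 4 (complement-* u v (complement i i<M)))
      where
      regroup : ∀ u v → 4 * (u * v) + 2 * u * (2 * u) ≡ 4 * (u * v + u * u)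
      regroup = solve-∀

  p∤pairFactor : ∀ i → p ∤ pairFactor i
  p∤pairFactor i p∣ with euclidsLemma (unitFactor p 0 i) (unitFactor p 0 (M ∸ suc i)) pp p∣
  ... | inj₁ p∣u = p∤unitFactor0 i p∣u
  ... | inj₂ p∣v = p∤unitFactor0 (M ∸ suc i) p∣v

  mod-N⇒mod-p^ : ∀ {a b} → a ≡ b mod N → a ≡ b mod p ^ suc j
  mod-N⇒mod-p^ {a} {b} = subst (λ z → a ≡ b mod z) N≡p^[1+j]

  mod-p^⇒mod-N : ∀ {a b} → a ≡ b mod p ^ suc j → a ≡ b mod N
  mod-p^⇒mod-N {a} {b} = subst (λ z → a ≡ b mod z) (sym N≡p^[1+j])

  prod-scale≡1 : 1 ≡ prod scale M mod N
  prod-scale≡1 = mod-p^⇒mod-N (mod-cancelˡ pp (prime∤prod pp M pairFactor (λ i _ → p∤pairFactor i)) (suc j)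
    (mod-N⇒mod-p^ (mod-resp (trans (prod-permute M doubling pairFactor) (sym (*-identityʳ _))) (trans (prod-* M scale pairFactor) (*-comm (prod scale M) (prod pairFactor M)))
                             (mod-prod M pairFactor-σ))))

  4L≡L : 4 * L ≡ L mod N
  4L≡L = mod-trans (mod-resp refl (slope-scale 4 M scale pairFactor unitIndicator scale-4) (mod-*ˡ 4 L≡scaled))
                   (mod-resp refl (*-identityˡ L) (mod-* (mod-sym prod-scale≡1) (mod-refl L)))
    where
    L≡scaled : L ≡ slope (λ i → scale i * pairFactor i) unitIndicator M mod N
    L≡scaled = mod-resp (trans (slope-cong M (λ _ _ → refl) (λ i i<M → sym (unitIndicator-σ i i<M))) (slope-permute M doubling pairFactor unitIndicator)) refl
                        (slope-mod M unitIndicator pairFactor-σ)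
    scale-4 : ∀ i → i < M → unitIndicator i * 4 ≡ unitIndicator i * scale i
    scale-4 i _ with suc i % p
    ... | zero  = refl
    ... | suc _ = refl

  N∣L : N ∣ L
  N∣L = subst (_∣ L) (sym N≡p^[1+j]) (prime^∣*-cancelˡ pp p∤3 (suc j)
    (subst (_∣ 3 * L) N≡p^[1+j] (≡0mod⇒∣ (mod-+-cancelʳ L (mod-resp (split L) refl 4L≡L)))))
    where
    split : ∀ L → 4 * L ≡ 3 * L + L
    split = solve-∀

mod-telescope : ∀ {M} (f : ℕ → ℕ) e → (∀ i → f (suc (e + i)) ≡ f (e + i) mod M) → ∀ d → f (e + d) ≡ f e mod M
mod-telescope f e step zero    = mod-resp (cong f (sym (+-identityʳ e))) refl (mod-refl (f e))
mod-telescope f e step (suc d) = mod-trans (mod-resp (cong f (sym (+-suc e d))) refl (step d)) (mod-telescope f e step d)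

binom-tower : ∀ p (E : ℕ → ℕ) → (∀ j n m → binom (n * p ^ suc j) (m * p ^ suc j) ≡ binom (n * p ^ j) (m * p ^ j) mod p ^ E j) →
              ∀ {k} e → e ≤ k → (∀ d → k ≤ E (e + d)) →
              ∀ n m → binom (n * p ^ k) (m * p ^ k) ≡ binom (n * p ^ e) (m * p ^ e) mod p ^ k
binom-tower p E step {k} e e≤k k≤E n m =
  mod-resp (cong f (m+[n∸m]≡n e≤k)) refl
    (mod-telescope f e (λ i → mod-weaken (^-monoʳ-∣ p (k≤E i)) (step (e + i) n m)) (k ∸ e))
  where
  f : ℕ → ℕ
  f j = binom (n * p ^ j) (m * p ^ j)

lucas-reduction : ∀ {p} (pp : Prime p) k e n m n₀ m₀ → 1 ≤ k → n₀ < p → m₀ < p →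
                  binom (n * p ^ k) (m * p ^ k) ≡ binom (n * p ^ e) (m * p ^ e) mod p ^ k →
                  ModEq (p ^ k) {{m^n≢0 p k {{prime⇒nonZero pp}}}}
                    ((n * p ^ k + n₀) C (m * p ^ k + m₀)) (((n * p ^ e) C (m * p ^ e)) * (n₀ C m₀))
lucas-reduction {p} pp (suc k) e n m n₀ m₀ _ n₀<p m₀<p top =
  mod⇒ModEq {{m^n≢0 p (suc k) {{prime⇒nonZero pp}}}}
    (mod-resp (trans (cong (λ x → binom (n * p ^ suc k + n₀) (x + m₀)) p*m*p^k) (sym (C≡binom (n * p ^ suc k + n₀) (m * p ^ suc k + m₀))))
              (sym (cong₂ _*_ (C≡binom (n * p ^ e) (m * p ^ e)) (C≡binom n₀ m₀)))
              (mod-trans (binom-lastDigit pp (suc k) (n * p ^ suc k) (divides n refl) n₀ (m * p ^ k) m₀ n₀<p m₀<p)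
                         (mod-* (mod-resp (cong (binom (n * p ^ suc k)) (sym p*m*p^k)) refl top) (mod-refl (binom n₀ m₀)))))
  where
  p*m*p^k : p * (m * p ^ k) ≡ m * p ^ suc k
  p*m*p^k = swap p m (p ^ k)
    where
    swap : ∀ p m x → p * (m * x) ≡ m * (p * x)
    swap = solve-∀

m<n*[1+m/n+o] : ∀ x c d .{{_ : NonZero c}} → x < c * suc (x / c + d)
m<n*[1+m/n+o] x c d = subst₂ _<_ (sym (m≡m%n+[m/n]*n x c)) (regroup c (x / c) d)
  (<-≤-trans (+-monoˡ-< (x / c * c) (m%n<n x c)) (m≤m+n (c + x / c * c) (d * c)))
  where
  regroup : ∀ c q d → c + q * c + d * c ≡ c * suc (q + d)
  regroup = solve-∀

binom-step-≥5 : ∀ p′ (pp : Prime (suc p′)) → 5 ≤ suc p′ → ∀ j n m →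
  binom (n * suc p′ ^ suc j) (m * suc p′ ^ suc j) ≡ binom (n * suc p′ ^ j) (m * suc p′ ^ j) mod suc p′ ^ (suc j + suc j + suc j)
binom-step-≥5 p′ pp 5≤p j = binom-step (suc j + suc j + suc j) (unitProd-shift-N∣L (≤-trans (m≤m+n 3 2) 5≤p) N∣L)
  where
  open UnitProducts p′ j pp
  open SlopeDivisibility p′ j pp 5≤p using (N∣L)

binom-step-3 : ∀ j n m → binom (n * 3 ^ suc j) (m * 3 ^ suc j) ≡ binom (n * 3 ^ j) (m * 3 ^ j) mod 3 ^ (suc j + suc j)
binom-step-3 j = binom-step (suc j + suc j) (unitProd-shift-odd ≤-refl)
  where open UnitProducts 2 j (toWitness {a? = prime? 3} tt)

binom-step-2 : ∀ j n m → binom (n * 2 ^ suc j) (m * 2 ^ suc j) ≡ binom (n * 2 ^ j) (m * 2 ^ j) mod 2 ^ (suc j + j)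
binom-step-2 j = binom-step (suc j + j) (unitProd-shift-2 j)
  where open UnitProducts 1 j prime[2]

jacobsthal-≥5 : ∀ {p} (pp : Prime p) k n m n₀ m₀ → 1 ≤ k → n₀ < p → m₀ < p → 5 ≤ p →
  ModEq (p ^ k) {{m^n≢0 p k {{prime⇒nonZero pp}}}}
    ((n * p ^ k + n₀) C (m * p ^ k + m₀)) (((n * p ^ ((k ∸ 1) / 3)) C (m * p ^ ((k ∸ 1) / 3))) * (n₀ C m₀))
jacobsthal-≥5 {suc p′} pp (suc x) n m n₀ m₀ 1≤k n₀<p m₀<p 5≤p =
  lucas-reduction pp (suc x) (x / 3) n m n₀ m₀ 1≤k n₀<p m₀<p
    (binom-tower (suc p′) (λ j → suc j + suc j + suc j) (binom-step-≥5 p′ pp 5≤p) (x / 3) (≤-trans (m/n≤m x 3) (n≤1+n x))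
      (λ d → subst (suc x ≤_) (triple (x / 3 + d)) (m<n*[1+m/n+o] x 3 d)) n m)
  where
  triple : ∀ j → 3 * suc j ≡ suc j + suc j + suc j
  triple = solve-∀

jacobsthal-3 : ∀ k n m n₀ m₀ → 1 ≤ k → n₀ < 3 → m₀ < 3 →
  ModEq (3 ^ k) {{m^n≢0 3 k}} ((n * 3 ^ k + n₀) C (m * 3 ^ k + m₀)) (((n * 3 ^ ((k ∸ 1) / 2)) C (m * 3 ^ ((k ∸ 1) / 2))) * (n₀ C m₀))
jacobsthal-3 (suc x) n m n₀ m₀ 1≤k n₀<3 m₀<3 =
  lucas-reduction (toWitness {a? = prime? 3} tt) (suc x) (x / 2) n m n₀ m₀ 1≤k n₀<3 m₀<3
    (binom-tower 3 (λ j → suc j + suc j) binom-step-3 (x / 2) (≤-trans (m/n≤m x 2) (n≤1+n x))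
      (λ d → subst (suc x ≤_) (double (x / 2 + d)) (m<n*[1+m/n+o] x 2 d)) n m)
  where
  double : ∀ j → 2 * suc j ≡ suc j + suc j
  double = solve-∀

jacobsthal-2 : ∀ k n m n₀ m₀ → 1 ≤ k → n₀ < 2 → m₀ < 2 →
  ModEq (2 ^ k) {{m^n≢0 2 k}} ((n * 2 ^ k + n₀) C (m * 2 ^ k + m₀)) (((n * 2 ^ (k / 2)) C (m * 2 ^ (k / 2))) * (n₀ C m₀))
jacobsthal-2 k n m n₀ m₀ 1≤k n₀<2 m₀<2 =
  lucas-reduction prime[2] k (k / 2) n m n₀ m₀ 1≤k n₀<2 m₀<2
    (binom-tower 2 (λ j → suc j + j) binom-step-2 (k / 2) (m/n≤m k 2)
      (λ d → s≤s⁻¹ (subst (suc k ≤_) (double (k / 2 + d)) (m<n*[1+m/n+o] k 2 d))) n m)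
  where
  double : ∀ j → 2 * suc j ≡ suc (suc j + j)
  double = solve-∀

mainTheorem1 : (p : ℕ) → (pp : Prime p) → (k n m n₀ m₀ : ℕ) → 1 ≤ k → n₀ < p → m₀ < p →
    ((5 ≤ p → ModEq (p ^ k) {{m^n≢0 p k {{prime⇒nonZero pp}}}}
                ((n * p ^ k + n₀) C (m * p ^ k + m₀))
                (((n * p ^ ((k ∸ 1) / 3)) C (m * p ^ ((k ∸ 1) / 3))) * (n₀ C m₀)))
    × (p ≡ 2 → ModEq (2 ^ k) {{m^n≢0 2 k}}
                ((n * 2 ^ k + n₀) C (m * 2 ^ k + m₀))
                (((n * 2 ^ (k / 2)) C (m * 2 ^ (k / 2))) * (n₀ C m₀)))
    × (p ≡ 3 → ModEq (3 ^ k) {{m^n≢0 3 k}}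
                ((n * 3 ^ k + n₀) C (m * 3 ^ k + m₀))
                (((n * 3 ^ ((k ∸ 1) / 2)) C (m * 3 ^ ((k ∸ 1) / 2))) * (n₀ C m₀))))
mainTheorem1 p pp k n m n₀ m₀ 1≤k n₀<p m₀<p =
  jacobsthal-≥5 pp k n m n₀ m₀ 1≤k n₀<p m₀<p ,
  (λ { refl → jacobsthal-2 k n m n₀ m₀ 1≤k n₀<p m₀<p }) ,
  (λ { refl → jacobsthal-3 k n m n₀ m₀ 1≤k n₀<p m₀<p })
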